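{- Let $\mathfrak{R}$ be either $\mathbb{F}_q$ ($q$ a prime power) or $\mathbb{Z}_k$ ($k\ge2$), let $g,n$ be positive integers, let $C$ be an $\mathfrak{R}$-linear code of length $n$ and let $v\in\mathfrak{R}^n$. Then, as rational functions in the indeterminates $y_a$ ($a\in\mathfrak{R}^{g+1}$), \[ \mathfrak{Jac}^{(g)}_{C,v}(\{y_a\}_{a\in\mathfrak{R}^{g+1}}) = y_0^n\prod_{\ell\in\mathfrak{R}^\ast}\Big(\frac{y_{(0,\ldots,0,\ell)}}{y_0}\Big)^{\mathrm{wt}_\ell(v)}\, Jac^{(g)}_{C,v}\Big(X_{(k),(\ell)}\leftarrow \frac{y_{L_{(k)}}}{y_0},\ X_{K,L}\leftarrow\prod_{K'\subset K}y_{L_{K'}}^{(-1)^{|K|-|K'|}}\Big), \] where the first substitution is for $k\in[g]$, $\ell\in\mathfrak{R}^\ast$, and the second for $2\le p\le g+1$, $K\in\binom{[g+1]}{p}$, $L\in(\mathfrak{R}^\ast)^p$.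
   Context: $\mathfrak{R}^\ast=\mathfrak{R}\setminus\{0\}$; an $\mathfrak{R}$-linear code is a subspace/submodule of $\mathfrak{R}^n$. For $u\in\mathfrak{R}^n$, $\mathrm{wt}_\ell(u)=\#\{i: u_i=\ell\}$. $[m]=\{1,\ldots,m\}$; $\binom{[m]}{p}$ is the set of tuples $K=(K_1,\ldots,K_p)$ with $1\le K_1<\cdots<K_p\le m$, $|K|=p$. For $w_1,\ldots,w_m\in\mathfrak{R}^n$, $c\in\mathfrak{R}^m$, $n_c(w_1,\ldots,w_m)=\#\{i:(w_{1,i},\ldots,w_{m,i})=c\}$. Homogeneous Jacobi polynomial: $\mathfrak{Jac}^{(g)}_{C,v}=\sum_{u_1,\ldots,u_g\in C}\prod_{a\in\mathfrak{R}^{g+1}}y_a^{n_a(u_1,\ldots,u_g,v)}$ (sum over all $g$-tuples of codewords, repetitions allowed). Inhomogeneous Jacobi polynomial: in indeterminates $X_{K,L}$ for $1\le p\le g+1$, $K\in\binom{[g+1]}{p}$, $L\in(\mathfrak{R}^\ast)^p$, except that $X_{(g+1),(\ell)}$ is set equal to $1$ for all $\ell\in\mathfrak{R}^\ast$, $Jac^{(g)}_{C,v}=\sum_{u_1,\ldots,u_g\in C}\prod_{1\le p\le g+1}\prod_{K\in\binom{[g+1]}{p}}\prod_{L\in(\mathfrak{R}^\ast)^p}X_{K,L}^{n_L(u_{K_1},\ldots,u_{K_p})}$ with $u_{g+1}:=v$. $y_0$ is the variable for the zero vector. $L_{(k)}$ is the length-$(g+1)$ vector with entry $\ell$ in position $k$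 and $0$ elsewhere. For increasing tuples, $K'\subset K$ means $K'=(K_{m_1},\ldots,K_{m_r})$ is a subtuple ($m_1<\cdots<m_r$, possibly empty $\emptyset$); for $L=(L_1,\ldots,L_p)$, $L_{K'}$ is the length-$(g+1)$ vector whose entry at position $K_{m_j}$ is $L_{m_j}$ ($1\le j\le r$) and whose other entries are $0$; $L_\emptyset=0$. -}

module Defs where

open import Level using (Level; 0ℓ)
open import Algebra.Bundles using (CommutativeRing)
open import Data.Nat as ℕ using (ℕ; zero; suc)
open import Data.Nat.DivMod using (_mod_)
open import Data.Fin as Fin using (Fin; toℕ)
open import Data.Vec as Vec using (Vec; []; _∷_; lookup; _∷ʳ_; replicate; zipWith; _[_]≔_)
open import Data.Vec.Properties using (≡-dec)
open import Data.Vec.Relation.Unary.All as VAll using (All; all?)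
open import Data.List as List using (List; []; _∷_; filter; filterᵇ; map; foldr; concatMap; length; allFin; upTo)
open import Data.Bool using (Bool; true; false; if_then_else_; not)
open import Data.Product using (Σ; ∃; _×_)
open import Relation.Nullary using (¬_; Dec; yes; no)
open import Relation.Nullary.Decidable using (⌊_⌋)
open import Relation.Unary using (Decidable)
open import Relation.Binary using (DecidableEquality)
open import Relation.Binary.PropositionalEquality using (_≡_; _≢_)
open import Function.Definitions using (Bijective)

vecsOf : ∀ {a} {A : Set a} → List A → (m : ℕ) → List (Vec A m)
vecsOf xs zero    = [] ∷ []
vecsOf xs (suc m) = concatMap (λ x → map (x ∷_) (vecsOf xs m)) xs

isIncreasing : ∀ {m p} → Vec (Fin m) p → Bool
isIncreasing []            = true
isIncreasing (k ∷ [])      = true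
isIncreasing (k ∷ k' ∷ K)  = if ⌊ k Fin.<? k' ⌋ then isIncreasing (k' ∷ K) else false

-- binom([m], p) : all increasing tuples of length p in [m] (here [m] = Fin m)
subsetsOf : (m p : ℕ) → List (Vec (Fin m) p)
subsetsOf m p = filterᵇ isIncreasing (vecsOf (allFin m) p)

isEven : ℕ → Bool
isEven zero          = true
isEven (suc zero)    = false
isEven (suc (suc k)) = isEven k

countFalse : ∀ {p} → Vec Bool p → ℕ
countFalse []           = zero
countFalse (true ∷ bs)  = countFalse bs
countFalse (false ∷ bs) = suc (countFalse bs)

module _ (R : CommutativeRing 0ℓ 0ℓ) where
  open CommutativeRing R

  -- finite (given the enumeration in the theorem) commutative ring in which
  -- every nonzero element is invertible; i.e. a finite field F_q
  IsField : Set
  IsField = (1# ≢ 0#) × (∀ x → x ≢ 0# → ∃ λ y → x * y ≡ 1#)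

  -- R is isomorphic as a ring to ℤ_k = Fin k with arithmetic mod k, k = 2 + k'
  IsZmod : Set
  IsZmod = Σ ℕ λ k' → Σ (Carrier → Fin (suc (suc k'))) λ f →
             Bijective _≡_ _≡_ f
           × (∀ x y → f (x + y) ≡ (toℕ (f x) ℕ.+ toℕ (f y)) mod (suc (suc k')))
           × (∀ x y → f (x * y) ≡ (toℕ (f x) ℕ.* toℕ (f y)) mod (suc (suc k')))
           × (f 1# ≡ 1 mod (suc (suc k')))

  record IsLinearCode {n : ℕ} (C : Vec Carrier n → Set) : Set where
    field
      zero-mem : C (replicate n 0#)
      +-closed : ∀ {u w} → C u → C w → C (zipWith _+_ u w)
      ·-closed : ∀ r {u} → C u → C (Vec.map (r *_) u)

-- Jacobi polynomials, evaluated in an arbitrary commutative ring S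

module Jacobi {c ℓ : Level} (R : CommutativeRing 0ℓ 0ℓ)
              (_≟_ : DecidableEquality (CommutativeRing.Carrier R))
              (elems : List (CommutativeRing.Carrier R))
              (S : CommutativeRing c ℓ) where
  private
    module 𝔑 = CommutativeRing R
    module S = CommutativeRing S
  open 𝔑 using () renaming (Carrier to 𝔯)
  open S using () renaming (Carrier to T)

  nonzero : List 𝔯
  nonzero = filterᵇ (λ x → not ⌊ x ≟ 𝔑.0# ⌋) elems

  sumL : List T → T
  sumL = foldr S._+_ S.0#

  prodL : List T → T
  prodL = foldr S._*_ S.1#

  pow : T → ℕ → T
  pow x zero    = S.1#
  pow x (suc k) = x S.* pow x k

  nc : ∀ {n m} → Vec (Vec 𝔯 n) m → Vec 𝔯 m → ℕ
  nc {n} ws cc = length (filter (λ i → ≡-dec _≟_ (Vec.map (λ w → lookup w i) ws) cc) (allFin n))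

  wt : ∀ {n} → 𝔯 → Vec 𝔯 n → ℕ
  wt {n} l u = length (filter (λ i → lookup u i ≟ l) (allFin n))

  codeTuples : ∀ {n} (C : Vec 𝔯 n → Set) → Decidable C → (g : ℕ) → List (Vec (Vec 𝔯 n) g)
  codeTuples {n} C C? g = filter (all? C?) (vecsOf (vecsOf elems n) g)

  zeroV : ∀ {m} → Vec 𝔯 m
  zeroV {m} = replicate m 𝔑.0#

  Lk : ∀ {m} → Fin m → 𝔯 → Vec 𝔯 m
  Lk k l = zeroV [ k ]≔ l

  place : ∀ {m p} → Vec (Fin m) p → Vec 𝔯 p → Vec 𝔯 m
  place []      []      = zeroV
  place (k ∷ K) (l ∷ L) = place K L [ k ]≔ l

  -- L_{K'} where the subtuple K' ⊂ K is given by a mask on the positions of K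
  -- (true = position kept); |K| - |K'| = number of false entries of the mask
  LSub : ∀ {m p} → Vec (Fin m) p → Vec 𝔯 p → Vec Bool p → Vec 𝔯 m
  LSub K L mask = place K (zipWith (λ b l → if b then l else 𝔑.0#) mask L)

  module _ (g n : ℕ) (C : Vec 𝔯 n → Set) (C? : Decidable C) (v : Vec 𝔯 n) where

    hJac : (Vec 𝔯 (suc g) → T) → T
    hJac y = sumL (map (λ us →
               prodL (map (λ a → pow (y a) (nc (us ∷ʳ v) a)) (vecsOf elems (suc g))))
               (codeTuples C C? g))

    -- the variable X_{(g+1),(ℓ)} is set to 1
    Xfix : ((p : ℕ) → Vec (Fin (suc g)) p → Vec 𝔯 p → T) →
           (p : ℕ) → Vec (Fin (suc g)) p → Vec 𝔯 p → T
    Xfix X (suc zero) (k ∷ []) L = if ⌊ k Fin.≟ Fin.fromℕ g ⌋ then S.1# else X 1 (k ∷ []) L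
    Xfix X p K L = X p K L

    iJac : ((p : ℕ) → Vec (Fin (suc g)) p → Vec 𝔯 p → T) → T
    iJac X = sumL (map (λ us →
               prodL (map (λ p →
                 prodL (map (λ K →
                   prodL (map (λ L →
                     pow (Xfix X p K L) (nc (Vec.map (lookup (us ∷ʳ v)) K) L))
                     (vecsOf nonzero p)))
                   (subsetsOf (suc g) p)))
                 (map suc (upTo (suc g)))))
               (codeTuples C C? g))

    module _ (y yinv : Vec 𝔯 (suc g) → T) where
      substX : (p : ℕ) → Vec (Fin (suc g)) p → Vec 𝔯 p → T
      substX (suc zero) (k ∷ []) (l ∷ []) = y (Lk k l) S.* yinv zeroV
      substX p K L = prodL (map (λ mask →
                        if isEven (countFalse mask) then y (LSub K L mask) else yinv (LSub K L mask))
                        (vecsOf (true ∷ false ∷ []) p))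

      rhs : T
      rhs = (pow (y zeroV) n
             S.* prodL (map (λ l → pow (y (Lk (Fin.fromℕ g) l) S.* yinv zeroV) (wt l v)) nonzero))
            S.* iJac substX

module Submission where

-- Both sides factor over the coordinates. At a coordinate with column c = (u_1,…,u_g,v)_i ∈ 𝔑^{g+1}, the left
-- side contributes y_c and the right side y_0 (y_{L_(g+1)}/y_0)^{[c_{g+1} ≠ 0]} ∏_K X_{K,c_K}, over the nonempty
-- increasing K on which c is nonzero, with X_{(g+1),(ℓ)} = 1. After the substitution
-- X_{K,c_K} = ∏_{K' ⊆ K} y_{c|K'}^{(-1)^{|K|-|K'|}}, so Möbius inversion on the subsets of supp c collapses
-- y_0 ∏_K X_{K,c_K} to y_{c|supp c} = y_c; and y_{L_(g+1)}/y_0 is precisely the factor X_{(g+1),(c_{g+1})}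
-- that the convention X_{(g+1),(ℓ)} = 1 removed.

open import Defs
open import Level using (Level; 0ℓ)
open import Algebra.Bundles using (CommutativeMonoid; Semiring; CommutativeRing)
import Algebra.Properties.CommutativeSemigroup as CommSemigroupProperties
import Algebra.Definitions.RawMonoid as RawMonoidDefinitions
open import Data.Nat as ℕ using (ℕ; zero; suc; _≤_)
open import Data.List as List using (List; []; _∷_; map; foldr; filter; length; _++_; allFin; upTo)
import Data.List.Properties as List
open import Data.List.Membership.Propositional using (_∈_; _∉_)
open import Data.List.Membership.Propositional.Properties
  using ( ∈-map⁺; ∈-map⁻; ∈-filter⁺; ∈-filter⁻; ∈-allFin; ∈-upTo⁺
        ; ∈-cartesianProductWith⁺; ∈-cartesianProductWith⁻)
import Data.List.Membership.DecPropositional as DecMembership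
open import Data.List.Relation.Unary.Any using (here; there)
import Data.List.Relation.Unary.All as All
open import Data.List.Relation.Unary.AllPairs using ([]; _∷_)
open import Data.List.Relation.Unary.Unique.Propositional using (Unique)
import Data.List.Relation.Unary.Unique.Propositional.Properties as Unique
open import Data.Vec as Vec using (Vec; []; _∷_; _∷ʳ_; _[_]≔_)
open import Data.Fin as Fin using (Fin; zero; suc)
open import Data.Fin.Subset using (Subset; ⊥; ∣_∣; _─_)
import Data.Fin.Subset.Properties as Subset
import Data.Vec.Properties as Vec
import Data.Vec.Relation.Unary.All as VAll
open import Data.Bool as Bool using (Bool; true; false; not; _∧_; if_then_else_; T; T?)
open import Data.Bool.Properties using (T-≡; T-∧; ∧-identityʳ; not-involutive)
open import Data.Product using (∃; _,_; proj₂)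
open import Data.Sum using (_⊎_)
open import Function using (id; _∘_)
open import Function.Bundles using (Equivalence; _⇔_; mk⇔)
open import Data.Empty using (⊥-elim)
open import Relation.Nullary using (Dec; yes; no; does)
open import Relation.Nullary.Decidable using (⌊_⌋; dec-false)
open import Relation.Unary using (Decidable)
open import Relation.Binary using (DecidableEquality)
open import Relation.Binary.PropositionalEquality as ≡ using (_≡_; _≢_)

module Products {c ℓ : Level} (M : CommutativeMonoid c ℓ) where
  open CommutativeMonoid M
  open RawMonoidDefinitions rawMonoid using (_×_)
  open CommSemigroupProperties commutativeSemigroup using (interchange)
  open import Relation.Binary.Reasoning.Setoid setoid

  ∏ : List Carrier → Carrier
  ∏ = foldr _∙_ ε

  _^_ : Carrier → ℕ → Carrier
  x ^ k = k × x

  module _ {a} {A : Set a} where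

    ∏-cong-∈ : (xs : List A) {f g : A → Carrier} → (∀ x → x ∈ xs → f x ≈ g x) →
               ∏ (map f xs) ≈ ∏ (map g xs)
    ∏-cong-∈ []       f≈g = refl
    ∏-cong-∈ (x ∷ xs) f≈g = ∙-cong (f≈g x (here ≡.refl)) (∏-cong-∈ xs (λ y y∈ → f≈g y (there y∈)))

    ∏-cong : (xs : List A) {f g : A → Carrier} → (∀ x → f x ≈ g x) → ∏ (map f xs) ≈ ∏ (map g xs)
    ∏-cong xs f≈g = ∏-cong-∈ xs (λ x _ → f≈g x)

    ∏-≈ε : (xs : List A) {f : A → Carrier} → (∀ x → x ∈ xs → f x ≈ ε) → ∏ (map f xs) ≈ ε
    ∏-≈ε []       f≈ε = refl
    ∏-≈ε (x ∷ xs) f≈ε =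
      trans (∙-cong (f≈ε x (here ≡.refl)) (∏-≈ε xs (λ y y∈ → f≈ε y (there y∈)))) (identityˡ ε)

    ∏-distrib : (xs : List A) (f g : A → Carrier) →
                ∏ (map (λ x → f x ∙ g x) xs) ≈ ∏ (map f xs) ∙ ∏ (map g xs)
    ∏-distrib []       f g = sym (identityˡ ε)
    ∏-distrib (x ∷ xs) f g = trans (∙-congˡ (∏-distrib xs f g)) (interchange (f x) (g x) _ _)

    ∏-const : (xs : List A) (x : Carrier) → ∏ (map (λ _ → x) xs) ≡ x ^ length xs
    ∏-const []       x = ≡.refl
    ∏-const (_ ∷ xs) x = ≡.cong (x ∙_) (∏-const xs x)

    ∏-indicator : {p : Level} {P : A → Set p} (P? : Decidable P) (xs : List A) (x : Carrier) →
                  x ^ length (filter P? xs) ≈ ∏ (map (λ i → if does (P? i) then x else ε) xs)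
    ∏-indicator P? []       x = refl
    ∏-indicator P? (i ∷ xs) x with does (P? i)
    ... | true  = ∙-congˡ (∏-indicator P? xs x)
    ... | false = trans (∏-indicator P? xs x) (sym (identityˡ _))

    ∏-single : (xs : List A) (f : A → Carrier) {x : A} → Unique xs → x ∈ xs →
               (∀ y → y ≢ x → f y ≈ ε) → ∏ (map f xs) ≈ f x
    ∏-single (y ∷ xs) f (y∉ ∷ _) (here ≡.refl) f≈ε =
      trans (∙-congˡ (∏-≈ε xs (λ z z∈ → f≈ε z (λ z≡y → All.lookup y∉ z∈ (≡.sym z≡y))))) (identityʳ _)
    ∏-single (y ∷ xs) f (y∉ ∷ u) (there x∈) f≈ε =
      trans (∙-congʳ (f≈ε y (λ y≡x → All.lookup y∉ x∈ y≡x))) (trans (identityˡ _) (∏-single xs f u x∈ f≈ε))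

  ∏-swap : ∀ {a b} {A : Set a} {B : Set b} (xs : List A) (ys : List B) (f : A → B → Carrier) →
           ∏ (map (λ x → ∏ (map (f x) ys)) xs) ≈ ∏ (map (λ y → ∏ (map (λ x → f x y) xs)) ys)
  ∏-swap []       ys f = sym (∏-≈ε ys (λ _ _ → refl))
  ∏-swap (x ∷ xs) ys f = trans (∙-congˡ (∏-swap xs ys f)) (sym (∏-distrib ys (f x) _))

  ∏-++ : (xs ys : List Carrier) → ∏ (xs ++ ys) ≈ ∏ xs ∙ ∏ ys
  ∏-++ []       ys = sym (identityˡ _)
  ∏-++ (x ∷ xs) ys = trans (∙-congˡ (∏-++ xs ys)) (sym (assoc x _ _))

  module _ {a} {A : Set a} (_≟_ : DecidableEquality A) where

    δ : A → A → Carrier → Carrier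
    δ x y w = if does (x ≟ y) then w else ε

    δ-refl : ∀ x w → δ x x w ≈ w
    δ-refl x w with x ≟ x
    ... | yes _  = refl
    ... | no x≢x = ⊥-elim (x≢x ≡.refl)

    δ-comm : ∀ x y w → δ x y w ≡ δ y x w
    δ-comm x y w with x ≟ y | y ≟ x
    ... | yes _   | yes _   = ≡.refl
    ... | no _    | no _    = ≡.refl
    ... | yes x≡y | no y≢x  = ⊥-elim (y≢x (≡.sym x≡y))
    ... | no x≢y  | yes y≡x = ⊥-elim (x≢y (≡.sym y≡x))

    ∏-δ : (xs : List A) → Unique xs → ∀ {x} → x ∈ xs → (f : A → Carrier) →
          ∏ (map (λ y → δ x y (f y)) xs) ≈ f x
    ∏-δ xs u {x} x∈ f = trans (∏-single xs _ u x∈ off) (δ-refl x (f x))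
      where
      off : ∀ y → y ≢ x → δ x y (f y) ≈ ε
      off y y≢x with x ≟ y
      ... | yes x≡y = ⊥-elim (y≢x (≡.sym x≡y))
      ... | no _    = refl

    ∏-δ-∉ : (xs : List A) → ∀ {x} → x ∉ xs → (f : A → Carrier) →
            ∏ (map (λ y → δ x y (f y)) xs) ≈ ε
    ∏-δ-∉ xs {x} x∉ f = ∏-≈ε xs off
      where
      off : ∀ y → y ∈ xs → δ x y (f y) ≈ ε
      off y y∈ with x ≟ y
      ... | yes ≡.refl = ⊥-elim (x∉ y∈)
      ... | no _       = refl

    ∏-δ-⇔ : (xs : List A) → Unique xs → ∀ {x} (b : Bool) → (x ∈ xs ⇔ T b) → (f : A → Carrier) →
            ∏ (map (λ y → δ x y (f y)) xs) ≈ (if b then f x else ε)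
    ∏-δ-⇔ xs u true  x∈⇔ f = ∏-δ xs u (Equivalence.from x∈⇔ _) f
    ∏-δ-⇔ xs u false x∈⇔ f = ∏-δ-∉ xs (Equivalence.to x∈⇔) f

    ∏-reindex : ∀ {b} {B : Set b} (xs : List A) → Unique xs → (∀ x → x ∈ xs) →
                (ys : List B) (φ : B → A) → Unique (map φ ys) → (f : A → Carrier) →
                (∀ x → x ∉ map φ ys → f x ≈ ε) →
                ∏ (map (λ y → f (φ y)) ys) ≈ ∏ (map f xs)
    ∏-reindex xs uxs all∈ ys φ uim f off = begin
      ∏ (map (λ y → f (φ y)) ys)                          ≡⟨ ≡.cong ∏ (List.map-∘ ys) ⟩
      ∏ (map f im)                                         ≈⟨ ∏-cong im (λ z → sym (∏-δ xs uxs (all∈ z) f)) ⟩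
      ∏ (map (λ z → ∏ (map (λ x → δ z x (f x)) xs)) im)   ≈⟨ ∏-swap im xs _ ⟩
      ∏ (map (λ x → ∏ (map (λ z → δ z x (f x)) im)) xs)   ≈⟨ ∏-cong xs fibre ⟩
      ∏ (map f xs)                                         ∎
      where
      im = map φ ys
      open DecMembership _≟_ using (_∈?_)
      fibre : ∀ x → ∏ (map (λ z → δ z x (f x)) im) ≈ f x
      fibre x = trans (reflexive (≡.cong ∏ (List.map-cong (λ z → δ-comm z x (f x)) im))) (by (x ∈? im))
        where
        by : Dec (x ∈ im) → ∏ (map (λ z → δ x z (f x)) im) ≈ f x
        by (yes x∈) = ∏-δ im uim x∈ (λ _ → f x)
        by (no x∉)  = trans (∏-δ-∉ im x∉ (λ _ → f x)) (sym (off x x∉))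

module _ {a} {A : Set a} where

  vecsOf-suc : (xs : List A) (m : ℕ) → vecsOf xs (suc m) ≡ List.cartesianProductWith _∷_ xs (vecsOf xs m)
  vecsOf-suc xs m = prepend-each xs
    where
    prepend-each : (ys : List A) →
                   List.concatMap (λ y → map (y ∷_) (vecsOf xs m)) ys ≡ List.cartesianProductWith _∷_ ys (vecsOf xs m)
    prepend-each []       = ≡.refl
    prepend-each (y ∷ ys) = ≡.cong (map (y ∷_) (vecsOf xs m) ++_) (prepend-each ys)

  ∈-vecsOf⁺ : (xs : List A) {m : ℕ} {u : Vec A m} → VAll.All (_∈ xs) u → u ∈ vecsOf xs m
  ∈-vecsOf⁺ xs VAll.[]                     = here ≡.refl
  ∈-vecsOf⁺ xs {suc m} (x∈ VAll.∷ u∈) rewrite vecsOf-suc xs m =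
    ∈-cartesianProductWith⁺ _∷_ x∈ (∈-vecsOf⁺ xs u∈)

  ∈-vecsOf⁻ : (xs : List A) {m : ℕ} {u : Vec A m} → u ∈ vecsOf xs m → VAll.All (_∈ xs) u
  ∈-vecsOf⁻ xs {zero}  {[]} _ = VAll.[]
  ∈-vecsOf⁻ xs {suc m} u∈ rewrite vecsOf-suc xs m
    with _ , _ , x∈ , w∈ , ≡.refl ← ∈-cartesianProductWith⁻ _∷_ xs (vecsOf xs m) u∈
    = x∈ VAll.∷ ∈-vecsOf⁻ xs w∈

  ∈-vecsOf : {xs : List A} → (∀ x → x ∈ xs) → {m : ℕ} (u : Vec A m) → u ∈ vecsOf xs m
  ∈-vecsOf all∈ u = ∈-vecsOf⁺ _ (VAll.universal all∈ u)

  vecsOf-unique : {xs : List A} → Unique xs → (m : ℕ) → Unique (vecsOf xs m)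
  vecsOf-unique u zero    = All.[] ∷ []
  vecsOf-unique {xs} u (suc m) rewrite vecsOf-suc xs m =
    Unique.cartesianProductWith⁺ _∷_ Vec.∷-injective u (vecsOf-unique u m)

  map-unique-on : ∀ {b} {B : Set b} (φ : A → B) (xs : List A) → Unique xs →
                  (∀ {x y} → x ∈ xs → y ∈ xs → φ x ≡ φ y → x ≡ y) → Unique (map φ xs)
  map-unique-on φ []       _          _   = []
  map-unique-on φ (x ∷ xs) (x∉ ∷ u) inj =
    All.tabulate new ∷ map-unique-on φ xs u (λ p q → inj (there p) (there q))
    where
    new : ∀ {z} → z ∈ map φ xs → φ x ≢ z
    new z∈ φx≡z with ∈-map⁻ φ z∈
    ... | w , w∈ , ≡.refl = All.lookup x∉ w∈ (inj (here ≡.refl) (there w∈) φx≡z)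

subsets : (m : ℕ) → List (Subset m)
subsets = vecsOf (true ∷ false ∷ [])

∈-subsets : ∀ {m} (M : Subset m) → M ∈ subsets m
∈-subsets = ∈-vecsOf λ { true → here ≡.refl ; false → there (here ≡.refl) }

subsets-unique : ∀ m → Unique (subsets m)
subsets-unique = vecsOf-unique (((λ ()) All.∷ All.[]) ∷ (All.[] ∷ []))

infix 5 _⊆ᵇ_

_⊆ᵇ_ : ∀ {m} → Subset m → Subset m → Bool
[]          ⊆ᵇ []          = true
(true ∷ M)  ⊆ᵇ (true ∷ N)  = M ⊆ᵇ N
(true ∷ M)  ⊆ᵇ (false ∷ N) = false
(false ∷ M) ⊆ᵇ (_ ∷ N)     = M ⊆ᵇ N

module _ {a} {A : Set a} where

  scatter : ∀ {m p} → A → Vec (Fin m) p → Vec A p → Vec A m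
  scatter d []      []       = Vec.replicate _ d
  scatter d (k ∷ K) (x ∷ xs) = scatter d K xs [ k ]≔ x

  scatter-suc : ∀ {m p} (d : A) (K : Vec (Fin m) p) xs → scatter d (Vec.map suc K) xs ≡ d ∷ scatter d K xs
  scatter-suc d []      []       = ≡.refl
  scatter-suc d (k ∷ K) (x ∷ xs) = ≡.cong (_[ suc k ]≔ x) (scatter-suc d K xs)

  scatter-zero : ∀ {m p} (d : A) (K : Vec (Fin m) p) x xs →
                 scatter d (zero ∷ Vec.map suc K) (x ∷ xs) ≡ x ∷ scatter d K xs
  scatter-zero d K x xs = ≡.cong (_[ zero ]≔ x) (scatter-suc d K xs)

Increasing : ∀ {m p} → Vec (Fin m) p → Set
Increasing K = isIncreasing K ≡ true

private
  <?-suc : ∀ {m} (k k' : Fin m) → ⌊ suc k Fin.<? suc k' ⌋ ≡ ⌊ k Fin.<? k' ⌋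
  <?-suc k k' with suc k Fin.<? suc k' | k Fin.<? k'
  ... | yes _  | yes _  = ≡.refl
  ... | no _   | no _   = ≡.refl
  ... | yes sk<sk' | no k≮k' = ⊥-elim (k≮k' (ℕ.s<s⁻¹ sk<sk'))
  ... | no sk≮sk'  | yes k<k' = ⊥-elim (sk≮sk' (ℕ.s<s k<k'))

isIncreasing-suc : ∀ {m p} (K : Vec (Fin m) p) → isIncreasing (Vec.map suc K) ≡ isIncreasing K
isIncreasing-suc []           = ≡.refl
isIncreasing-suc (k ∷ [])     = ≡.refl
isIncreasing-suc (k ∷ k' ∷ K) =
  ≡.cong₂ (λ b x → if b then x else false) (<?-suc k k') (isIncreasing-suc (k' ∷ K))

isIncreasing-zero : ∀ {m p} (K : Vec (Fin m) p) → isIncreasing (zero ∷ Vec.map suc K) ≡ isIncreasing K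
isIncreasing-zero []      = ≡.refl
isIncreasing-zero (k ∷ K) = isIncreasing-suc (k ∷ K)

Increasing-tail : ∀ {m p} (k : Fin m) (K : Vec (Fin m) p) → Increasing (k ∷ K) → Increasing K
Increasing-tail k []       _   = ≡.refl
Increasing-tail k (k' ∷ K) inc with ⌊ k Fin.<? k' ⌋
... | true = inc

data IncreasingView {m : ℕ} : ∀ {p} → Vec (Fin (suc m)) p → Set where
  avoids-zero : ∀ {p} (K : Vec (Fin m) p) → Increasing K → IncreasingView (Vec.map suc K)
  from-zero   : ∀ {p} (K : Vec (Fin m) p) → Increasing K → IncreasingView (zero ∷ Vec.map suc K)

increasingView : ∀ {m p} (K : Vec (Fin (suc m)) p) → Increasing K → IncreasingView K
increasingView []      _   = avoids-zero [] ≡.refl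
increasingView (k ∷ K) inc = cons k (increasingView K (Increasing-tail k K inc)) inc
  where
  cons : ∀ {m p} (k : Fin (suc m)) {K : Vec (Fin (suc m)) p} →
         IncreasingView K → Increasing (k ∷ K) → IncreasingView (k ∷ K)
  cons zero    (avoids-zero K i) _   = from-zero K i
  cons zero    (from-zero K i)   ()
  cons (suc k) (avoids-zero K i) inc = avoids-zero (k ∷ K) (≡.trans (≡.sym (isIncreasing-suc (k ∷ K))) inc)
  cons (suc k) (from-zero K i)   ()

toSubset : ∀ {m p} → Vec (Fin m) p → Subset m
toSubset K = scatter false K (Vec.replicate _ true)

∣toSubset∣ : ∀ {m p} (K : Vec (Fin m) p) → Increasing K → ∣ toSubset K ∣ ≡ p
∣toSubset∣ {zero} [] _ = ≡.refl
∣toSubset∣ {suc m} K inc with increasingView K inc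
... | avoids-zero K' i = ≡.trans (≡.cong ∣_∣ (scatter-suc false K' _)) (∣toSubset∣ K' i)
... | from-zero K' i   = ≡.trans (≡.cong ∣_∣ (scatter-zero false K' true _)) (≡.cong suc (∣toSubset∣ K' i))

scatter-injective : ∀ {a} {A : Set a} {m p} (d : A) (K : Vec (Fin m) p) → Increasing K →
                    (xs ys : Vec A p) → scatter d K xs ≡ scatter d K ys → xs ≡ ys
scatter-injective {m = zero} d [] _ [] [] _ = ≡.refl
scatter-injective {m = suc m} d K inc xs ys eq with increasingView K inc
... | avoids-zero K' i =
  scatter-injective d K' i xs ys
    (Vec.∷-injectiveʳ (≡.trans (≡.sym (scatter-suc d K' xs)) (≡.trans eq (scatter-suc d K' ys))))
scatter-injective {m = suc m} d K inc (x ∷ xs) (y ∷ ys) eq | from-zero K' i =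
  ≡.cong₂ _∷_ (Vec.∷-injectiveˡ eq′) (scatter-injective d K' i xs ys (Vec.∷-injectiveʳ eq′))
  where eq′ = ≡.trans (≡.sym (scatter-zero d K' x xs)) (≡.trans eq (scatter-zero d K' y ys))

toSubset-injective : ∀ {m p} (K K' : Vec (Fin m) p) → Increasing K → Increasing K' →
                     toSubset K ≡ toSubset K' → K ≡ K'
toSubset-injective {zero} [] [] _ _ _ = ≡.refl
toSubset-injective {suc m} K K' inc inc' eq with increasingView K inc | increasingView K' inc'
... | avoids-zero L i | avoids-zero L' i' =
  ≡.cong (Vec.map suc) (toSubset-injective L L' i i'
    (Vec.∷-injectiveʳ (≡.trans (≡.sym (scatter-suc false L _)) (≡.trans eq (scatter-suc false L' _)))))
... | from-zero L i | from-zero L' i' =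
  ≡.cong (λ J → zero ∷ Vec.map suc J) (toSubset-injective L L' i i'
    (Vec.∷-injectiveʳ (≡.trans (≡.sym (scatter-zero false L true _)) (≡.trans eq (scatter-zero false L' true _)))))
... | avoids-zero L i | from-zero L' i'
  with () ← Vec.∷-injectiveˡ (≡.trans (≡.sym (scatter-suc false L _)) (≡.trans eq (scatter-zero false L' true _)))
... | from-zero L i | avoids-zero L' i'
  with () ← Vec.∷-injectiveˡ (≡.trans (≡.sym (scatter-zero false L true _)) (≡.trans eq (scatter-suc false L' _)))

fromSubset : ∀ {m} (M : Subset m) → Vec (Fin m) ∣ M ∣
fromSubset []          = []
fromSubset (true ∷ M)  = zero ∷ Vec.map suc (fromSubset M)
fromSubset (false ∷ M) = Vec.map suc (fromSubset M)

fromSubset-increasing : ∀ {m} (M : Subset m) → Increasing (fromSubset M)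
fromSubset-increasing []          = ≡.refl
fromSubset-increasing (true ∷ M)  = ≡.trans (isIncreasing-zero (fromSubset M)) (fromSubset-increasing M)
fromSubset-increasing (false ∷ M) = ≡.trans (isIncreasing-suc (fromSubset M)) (fromSubset-increasing M)

toSubset-fromSubset : ∀ {m} (M : Subset m) → toSubset (fromSubset M) ≡ M
toSubset-fromSubset []          = ≡.refl
toSubset-fromSubset (true ∷ M)  =
  ≡.trans (scatter-zero false (fromSubset M) true _) (≡.cong (true ∷_) (toSubset-fromSubset M))
toSubset-fromSubset (false ∷ M) =
  ≡.trans (scatter-suc false (fromSubset M) _) (≡.cong (false ∷_) (toSubset-fromSubset M))

∈-subsetsOf⁺ : ∀ {m p} (K : Vec (Fin m) p) → Increasing K → K ∈ subsetsOf m p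
∈-subsetsOf⁺ K inc = ∈-filter⁺ (T? ∘ isIncreasing) (∈-vecsOf ∈-allFin K) (Equivalence.from T-≡ inc)

∈-subsetsOf⁻ : ∀ {m p} {K : Vec (Fin m) p} → K ∈ subsetsOf m p → Increasing K
∈-subsetsOf⁻ {m} {p} K∈ = Equivalence.to T-≡ (proj₂ (∈-filter⁻ (T? ∘ isIncreasing) {xs = vecsOf (allFin m) p} K∈))

subsetsOf-unique : ∀ m p → Unique (subsetsOf m p)
subsetsOf-unique m p = Unique.filter⁺ (T? ∘ isIncreasing) (vecsOf-unique (Unique.allFin⁺ m) p)

toSubset-image : ∀ {m} (M : Subset m) → M ∈ map toSubset (subsetsOf m ∣ M ∣)
toSubset-image M = ≡.subst (_∈ map toSubset (subsetsOf _ ∣ M ∣)) (toSubset-fromSubset M)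
                     (∈-map⁺ toSubset (∈-subsetsOf⁺ (fromSubset M) (fromSubset-increasing M)))

toSubset-unique : ∀ m p → Unique (map toSubset (subsetsOf m p))
toSubset-unique m p = map-unique-on toSubset (subsetsOf m p) (subsetsOf-unique m p)
  (λ K∈ K'∈ → toSubset-injective _ _ (∈-subsetsOf⁻ K∈) (∈-subsetsOf⁻ K'∈))

scatter-⊆ᵇ : ∀ {m p} (K : Vec (Fin m) p) → Increasing K → (bs : Subset p) →
             scatter false K bs ⊆ᵇ toSubset K ≡ true
scatter-⊆ᵇ {zero} [] _ [] = ≡.refl
scatter-⊆ᵇ {suc m} K inc bs with increasingView K inc
... | avoids-zero K' i
  rewrite scatter-suc false K' bs | scatter-suc false K' (Vec.replicate _ true) = scatter-⊆ᵇ K' i bs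
scatter-⊆ᵇ {suc m} K inc (b ∷ bs) | from-zero K' i
  rewrite scatter-zero false K' b bs | scatter-zero false K' true (Vec.replicate _ true) with b
... | true  = scatter-⊆ᵇ K' i bs
... | false = scatter-⊆ᵇ K' i bs

∣toSubset─scatter∣ : ∀ {m p} (K : Vec (Fin m) p) → Increasing K → (bs : Subset p) →
                     ∣ toSubset K ─ scatter false K bs ∣ ≡ countFalse bs
∣toSubset─scatter∣ {zero} [] _ [] = ≡.refl
∣toSubset─scatter∣ {suc m} K inc bs with increasingView K inc
... | avoids-zero K' i
  rewrite scatter-suc false K' bs | scatter-suc false K' (Vec.replicate _ true) = ∣toSubset─scatter∣ K' i bs
∣toSubset─scatter∣ {suc m} K inc (b ∷ bs) | from-zero K' i
  rewrite scatter-zero false K' b bs | scatter-zero false K' true (Vec.replicate _ true) with b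
... | true  = ∣toSubset─scatter∣ K' i bs
... | false = ≡.cong suc (∣toSubset─scatter∣ K' i bs)

⊆ᵇ-toSubset⇒scatter : ∀ {m p} (K : Vec (Fin m) p) → Increasing K → (M : Subset m) → M ⊆ᵇ toSubset K ≡ true →
                      ∃ λ bs → scatter false K bs ≡ M
⊆ᵇ-toSubset⇒scatter {zero} [] _ [] _ = [] , ≡.refl
⊆ᵇ-toSubset⇒scatter {suc m} K inc M M⊆ with increasingView K inc
⊆ᵇ-toSubset⇒scatter {suc m} K inc (b ∷ M) M⊆ | avoids-zero K' i
  rewrite scatter-suc false K' (Vec.replicate _ true) with b
... | false = let bs , eq = ⊆ᵇ-toSubset⇒scatter K' i M M⊆ in
              bs , ≡.trans (scatter-suc false K' bs) (≡.cong (false ∷_) eq)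
⊆ᵇ-toSubset⇒scatter {suc m} K inc (b ∷ M) M⊆ | from-zero K' i
  rewrite scatter-zero false K' true (Vec.replicate _ true) =
  let bs , eq = ⊆ᵇ-toSubset⇒scatter K' i M (tail-⊆ᵇ b M⊆) in
  b ∷ bs , ≡.trans (scatter-zero false K' b bs) (≡.cong (b ∷_) eq)
  where
  tail-⊆ᵇ : ∀ b {M N : Subset m} → (b ∷ M) ⊆ᵇ (true ∷ N) ≡ true → M ⊆ᵇ N ≡ true
  tail-⊆ᵇ true  M⊆ = M⊆
  tail-⊆ᵇ false M⊆ = M⊆

isEven-suc : ∀ n → isEven (suc n) ≡ not (isEven n)
isEven-suc zero          = ≡.refl
isEven-suc (suc zero)    = ≡.refl
isEven-suc (suc (suc n)) = isEven-suc n

module Möbius {c ℓ : Level} (M : CommutativeMonoid c ℓ) where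
  open CommutativeMonoid M
  open Products M
  open import Relation.Binary.Reasoning.Setoid setoid

  ∏-subsets-suc : ∀ {m} (f : Subset (suc m) → Carrier) →
                  ∏ (map f (subsets (suc m)))
                    ≈ ∏ (map (f ∘ (true ∷_)) (subsets m)) ∙ ∏ (map (f ∘ (false ∷_)) (subsets m))
  ∏-subsets-suc {m} f = begin
    ∏ (map f (map (true ∷_) S ++ map (false ∷_) S ++ []))
      ≡⟨ ≡.cong ∏ (List.map-++ f (map (true ∷_) S) _) ⟩
    ∏ (map f (map (true ∷_) S) ++ map f (map (false ∷_) S ++ []))
      ≈⟨ ∏-++ (map f (map (true ∷_) S)) _ ⟩
    ∏ (map f (map (true ∷_) S)) ∙ ∏ (map f (map (false ∷_) S ++ []))
      ≡⟨ ≡.cong₂ (λ xs ys → ∏ xs ∙ ∏ ys) (≡.sym (List.map-∘ S))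
                 (≡.trans (≡.cong (map f) (List.++-identityʳ _)) (≡.sym (List.map-∘ S))) ⟩
    ∏ (map (f ∘ (true ∷_)) S) ∙ ∏ (map (f ∘ (false ∷_)) S) ∎
    where S = subsets m

  -- z M false stands for (z M)⁻¹, so that no group structure is needed.
  Signed : ℕ → Set c
  Signed m = Subset m → Bool → Carrier

  ∏⊆ : ∀ {m} → Subset m → (Subset m → Carrier) → Carrier
  ∏⊆ {m} S f = ∏ (map (λ M → if M ⊆ᵇ S then f M else ε) (subsets m))

  alternating : ∀ {m} → Signed m → Bool → Subset m → Carrier
  alternating z b M = ∏⊆ M (λ M' → z M' (if isEven ∣ M ─ M' ∣ then b else not b))

  private
    if-cong : ∀ (s : Bool) {x y : Carrier} → x ≈ y → (if s then x else ε) ≈ (if s then y else ε)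
    if-cong true  x≈y = x≈y
    if-cong false _   = refl

    if-∙ : ∀ (s : Bool) (x y : Carrier) → (if s then x ∙ y else ε) ≈ (if s then x else ε) ∙ (if s then y else ε)
    if-∙ true  x y = refl
    if-∙ false x y = sym (identityˡ ε)

    sign-flip : ∀ b e → (if not e then b else not b) ≡ (if e then not b else not (not b))
    sign-flip b true  = ≡.refl
    sign-flip b false = ≡.sym (not-involutive b)

  ∏⊆-true : ∀ {m} S (f : Subset (suc m) → Carrier) →
            ∏⊆ (true ∷ S) f ≈ ∏⊆ S (f ∘ (true ∷_)) ∙ ∏⊆ S (f ∘ (false ∷_))
  ∏⊆-true S f = ∏-subsets-suc (λ M → if M ⊆ᵇ (true ∷ S) then f M else ε)

  ∏⊆-false : ∀ {m} S (f : Subset (suc m) → Carrier) → ∏⊆ (false ∷ S) f ≈ ∏⊆ S (f ∘ (false ∷_))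
  ∏⊆-false {m} S f = trans (∏-subsets-suc (λ M → if M ⊆ᵇ (false ∷ S) then f M else ε))
                            (trans (∙-congʳ (∏-≈ε (subsets m) (λ _ _ → refl))) (identityˡ _))

  ∏⊆-cong : ∀ {m} S {f g : Subset m → Carrier} → (∀ M → f M ≈ g M) → ∏⊆ S f ≈ ∏⊆ S g
  ∏⊆-cong {m} S f≈g = ∏-cong (subsets m) (λ M → if-cong (M ⊆ᵇ S) (f≈g M))

  ∏⊆-distrib : ∀ {m} S (f g : Subset m → Carrier) → ∏⊆ S (λ M → f M ∙ g M) ≈ ∏⊆ S f ∙ ∏⊆ S g
  ∏⊆-distrib {m} S f g = trans (∏-cong (subsets m) (λ M → if-∙ (M ⊆ᵇ S) (f M) (g M))) (∏-distrib (subsets m) _ _)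

  alternating-true : ∀ {m} (z : Signed (suc m)) b M →
                     alternating z b (true ∷ M)
                       ≈ alternating (z ∘ (true ∷_)) b M ∙ alternating (z ∘ (false ∷_)) (not b) M
  alternating-true {m} z b M =
    trans (∏⊆-true M _) (∙-congˡ (∏⊆-cong M λ M' →
      reflexive (≡.cong (z (false ∷ M'))
        (≡.trans (≡.cong (λ e → if e then b else not b) (isEven-suc ∣ M ─ M' ∣))
                 (sign-flip b (isEven ∣ M ─ M' ∣))))))

  alternating-false : ∀ {m} (z : Signed (suc m)) b M → alternating z b (false ∷ M) ≈ alternating (z ∘ (false ∷_)) b M
  alternating-false z b M = ∏⊆-false M _

  möbius-inversion : ∀ {m} (z : Signed m) → (∀ M → z M true ∙ z M false ≈ ε) →
                     ∀ b S → ∏⊆ S (alternating z b) ≈ z S b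
  möbius-inversion {zero} z inv b [] = trans (identityʳ _) (identityʳ _)
  möbius-inversion {suc m} z inv b (false ∷ S) = begin
    ∏⊆ (false ∷ S) (alternating z b)     ≈⟨ ∏⊆-false S _ ⟩
    ∏⊆ S (alternating z b ∘ (false ∷_))  ≈⟨ ∏⊆-cong S (alternating-false z b) ⟩
    ∏⊆ S (alternating zᶠ b)              ≈⟨ möbius-inversion zᶠ (inv ∘ (false ∷_)) b S ⟩
    z (false ∷ S) b                      ∎
    where zᶠ = z ∘ (false ∷_)
  möbius-inversion {suc m} z inv b (true ∷ S) = begin
    ∏⊆ (true ∷ S) (alternating z b)
      ≈⟨ ∏⊆-true S _ ⟩
    ∏⊆ S (alternating z b ∘ (true ∷_)) ∙ ∏⊆ S (alternating z b ∘ (false ∷_))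
      ≈⟨ ∙-cong (trans (∏⊆-cong S (alternating-true z b)) (∏⊆-distrib S _ _))
                (∏⊆-cong S (alternating-false z b)) ⟩
    (∏⊆ S (alternating zᵗ b) ∙ ∏⊆ S (alternating zᶠ (not b))) ∙ ∏⊆ S (alternating zᶠ b)
      ≈⟨ ∙-cong (∙-cong (möbius-inversion zᵗ (inv ∘ (true ∷_)) b S)
                        (möbius-inversion zᶠ (inv ∘ (false ∷_)) (not b) S))
                (möbius-inversion zᶠ (inv ∘ (false ∷_)) b S) ⟩
    (z (true ∷ S) b ∙ z (false ∷ S) (not b)) ∙ z (false ∷ S) b
      ≈⟨ assoc _ _ _ ⟩
    z (true ∷ S) b ∙ (z (false ∷ S) (not b) ∙ z (false ∷ S) b)
      ≈⟨ ∙-congˡ (cancel b) ⟩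
    z (true ∷ S) b ∙ ε
      ≈⟨ identityʳ _ ⟩
    z (true ∷ S) b ∎
    where
    zᵗ = z ∘ (true ∷_)
    zᶠ = z ∘ (false ∷_)
    cancel : ∀ b → z (false ∷ S) (not b) ∙ z (false ∷ S) b ≈ ε
    cancel true  = trans (comm _ _) (inv (false ∷ S))
    cancel false = inv (false ∷ S)

upTo-suc : ∀ m → upTo (suc m) ≡ 0 ∷ map suc (upTo m)
upTo-suc m = ≡.cong (0 ∷_) (≡.sym (List.map-upTo suc m))

_≟ₛ_ : ∀ {m} → DecidableEquality (Subset m)
_≟ₛ_ = Vec.≡-dec Bool._≟_

module BySize {c ℓ : Level} (M : CommutativeMonoid c ℓ) where
  open CommutativeMonoid M
  open Products M
  open import Relation.Binary.Reasoning.Setoid setoid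

  ∏-tuples : ∀ m → ((p : ℕ) → Vec (Fin m) p → Carrier) → Carrier
  ∏-tuples m F = ∏ (map (λ p → ∏ (map (F p) (subsetsOf m p))) (map suc (upTo m)))

  ∏-tuples-cong : ∀ m {F G : (p : ℕ) → Vec (Fin m) p → Carrier} →
                  (∀ p K → Increasing K → F p K ≈ G p K) → ∏-tuples m F ≈ ∏-tuples m G
  ∏-tuples-cong m F≈G =
    ∏-cong (map suc (upTo m)) λ p → ∏-cong-∈ (subsetsOf m p) λ K K∈ → F≈G p K (∈-subsetsOf⁻ K∈)

  ∏-tuples-distrib : ∀ m (F G : (p : ℕ) → Vec (Fin m) p → Carrier) →
                     ∏-tuples m (λ p K → F p K ∙ G p K) ≈ ∏-tuples m F ∙ ∏-tuples m G
  ∏-tuples-distrib m F G =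
    trans (∏-cong (map suc (upTo m)) λ p → ∏-distrib (subsetsOf m p) (F p) (G p)) (∏-distrib (map suc (upTo m)) _ _)

  ∏-tuples-swap : ∀ {a} {A : Set a} m (xs : List A) (F : (p : ℕ) → Vec (Fin m) p → A → Carrier) →
                  ∏-tuples m (λ p K → ∏ (map (F p K) xs)) ≈ ∏ (map (λ x → ∏-tuples m (λ p K → F p K x)) xs)
  ∏-tuples-swap m xs F =
    trans (∏-cong (map suc (upTo m)) λ p → ∏-swap (subsetsOf m p) xs (F p)) (∏-swap (map suc (upTo m)) xs _)

  ∏-subsets-by-size : ∀ m (F : Subset m → Carrier) →
                      ∏ (map F (subsets m)) ≈ F ⊥ ∙ ∏-tuples m (λ _ → F ∘ toSubset)
  ∏-subsets-by-size m F = begin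
    ∏ (map F (subsets m))
      ≈⟨ ∏-cong (subsets m) (λ M → sym (∏-δ ℕ._≟_ (upTo (suc m)) (Unique.upTo⁺ _) (size∈ M) (λ _ → F M))) ⟩
    ∏ (map (λ M → ∏ (map (λ p → δ ℕ._≟_ ∣ M ∣ p (F M)) (upTo (suc m)))) (subsets m))
      ≈⟨ ∏-swap (subsets m) (upTo (suc m)) _ ⟩
    ∏ (map (λ p → ∏ (map (λ M → δ ℕ._≟_ ∣ M ∣ p (F M)) (subsets m))) (upTo (suc m)))
      ≈⟨ ∏-cong (upTo (suc m)) (λ p → sym (level p)) ⟩
    ∏ (map level-product (upTo (suc m)))
      ≡⟨ ≡.cong (∏ ∘ map level-product) (upTo-suc m) ⟩
    (F ⊥ ∙ ε) ∙ ∏-tuples m (λ _ → F ∘ toSubset)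
      ≈⟨ ∙-congʳ (identityʳ _) ⟩
    F ⊥ ∙ ∏-tuples m (λ _ → F ∘ toSubset) ∎
    where
    level-product : ℕ → Carrier
    level-product p = ∏ (map (F ∘ toSubset) (subsetsOf m p))

    size∈ : ∀ M → ∣ M ∣ ∈ upTo (suc m)
    size∈ M = ∈-upTo⁺ (ℕ.s≤s (Subset.∣p∣≤n M))

    level : ∀ p → level-product p ≈ ∏ (map (λ M → δ ℕ._≟_ ∣ M ∣ p (F M)) (subsets m))
    level p = trans (∏-cong-∈ (subsetsOf m p) (λ K K∈ → sym (on-size K (∈-subsetsOf⁻ K∈))))
                    (∏-reindex _≟ₛ_ (subsets m) (subsets-unique m) ∈-subsets (subsetsOf m p) toSubset
                       (toSubset-unique m p) _ off-size)
      where
      on-size : ∀ K → Increasing K → δ ℕ._≟_ ∣ toSubset K ∣ p (F (toSubset K)) ≈ F (toSubset K)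
      on-size K inc rewrite ∣toSubset∣ K inc = δ-refl ℕ._≟_ p _
      off-size : ∀ M → M ∉ map toSubset (subsetsOf m p) → δ ℕ._≟_ ∣ M ∣ p (F M) ≈ ε
      off-size M M∉ with ∣ M ∣ ℕ.≟ p
      ... | yes ≡.refl = ⊥-elim (M∉ (toSubset-image M))
      ... | no ∣M∣≢p   = reflexive (≡.cong (if_then F M else ε) (dec-false (∣ M ∣ ℕ.≟ p) ∣M∣≢p))

module Sums {c ℓ : Level} (R : Semiring c ℓ) where
  open Semiring R

  ∑ : List Carrier → Carrier
  ∑ = foldr _+_ 0#

  module _ {a} {A : Set a} where

    ∑-cong : (xs : List A) {f g : A → Carrier} → (∀ x → f x ≈ g x) → ∑ (map f xs) ≈ ∑ (map g xs)
    ∑-cong []       f≈g = refl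
    ∑-cong (x ∷ xs) f≈g = +-cong (f≈g x) (∑-cong xs f≈g)

    *-distribˡ-∑ : ∀ z (xs : List A) (f : A → Carrier) → z * ∑ (map f xs) ≈ ∑ (map (λ x → z * f x) xs)
    *-distribˡ-∑ z []       f = zeroʳ z
    *-distribˡ-∑ z (x ∷ xs) f = trans (distribˡ z (f x) _) (+-congˡ (*-distribˡ-∑ z xs f))

module JacobiIdentity
  (R : CommutativeRing 0ℓ 0ℓ) (_≟_ : DecidableEquality (CommutativeRing.Carrier R))
  (elems : List (CommutativeRing.Carrier R)) (complete : ∀ x → x ∈ elems) (elems-unique : Unique elems)
  {c ℓ : Level} (S : CommutativeRing c ℓ) where

  private
    module 𝔑 = CommutativeRing R
    𝔯 = 𝔑.Carrier
  open CommutativeRing S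
  open Products *-commutativeMonoid
  open Möbius *-commutativeMonoid
  open BySize *-commutativeMonoid
  open Sums semiring
  open Jacobi R _≟_ elems S
  open import Relation.Binary.Reasoning.Setoid setoid

  isNonzero : 𝔯 → Bool
  isNonzero x = not ⌊ x ≟ 𝔑.0# ⌋

  allNonzero : ∀ {p} → Vec 𝔯 p → Bool
  allNonzero []      = true
  allNonzero (x ∷ u) = isNonzero x ∧ allNonzero u

  support : ∀ {m} → Vec 𝔯 m → Subset m
  support = Vec.map isNonzero

  restrict : ∀ {m} → Subset m → Vec 𝔯 m → Vec 𝔯 m
  restrict = Vec.zipWith (λ b x → if b then x else 𝔑.0#)

  ∈-nonzero⇔ : ∀ {x} → x ∈ nonzero ⇔ T (isNonzero x)
  ∈-nonzero⇔ = mk⇔ (λ x∈ → proj₂ (∈-filter⁻ (T? ∘ isNonzero) {xs = elems} x∈))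
                   (∈-filter⁺ (T? ∘ isNonzero) (complete _))

  nonzero-unique : Unique nonzero
  nonzero-unique = Unique.filter⁺ (T? ∘ isNonzero) elems-unique

  All-nonzero⇔ : ∀ {p} {u : Vec 𝔯 p} → VAll.All (_∈ nonzero) u ⇔ T (allNonzero u)
  All-nonzero⇔ = mk⇔ to from
    where
    to : ∀ {p} {u : Vec 𝔯 p} → VAll.All (_∈ nonzero) u → T (allNonzero u)
    to VAll.[]         = _
    to (x∈ VAll.∷ u∈) = Equivalence.from T-∧ (Equivalence.to ∈-nonzero⇔ x∈ , to u∈)
    from : ∀ {p} {u : Vec 𝔯 p} → T (allNonzero u) → VAll.All (_∈ nonzero) u
    from {u = []}    _  = VAll.[]
    from {u = x ∷ u} nz = let x≠0 , u≠0 = Equivalence.to T-∧ nz in Equivalence.from ∈-nonzero⇔ x≠0 VAll.∷ from u≠0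

  ∈-nonzeroVecs⇔ : ∀ {p} {u : Vec 𝔯 p} → u ∈ vecsOf nonzero p ⇔ T (allNonzero u)
  ∈-nonzeroVecs⇔ = mk⇔ (Equivalence.to All-nonzero⇔ ∘ ∈-vecsOf⁻ nonzero)
                        (∈-vecsOf⁺ nonzero ∘ Equivalence.from All-nonzero⇔)

  restrict-support : ∀ {m} (c : Vec 𝔯 m) → restrict (support c) c ≡ c
  restrict-support []      = ≡.refl
  restrict-support (x ∷ c) with x ≟ 𝔑.0#
  ... | yes x≡0 = ≡.cong₂ _∷_ (≡.sym x≡0) (restrict-support c)
  ... | no _    = ≡.cong (x ∷_) (restrict-support c)

  restrict-⊥ : ∀ {m} (c : Vec 𝔯 m) → restrict ⊥ c ≡ zeroV
  restrict-⊥ []      = ≡.refl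
  restrict-⊥ (x ∷ c) = ≡.cong (𝔑.0# ∷_) (restrict-⊥ c)

  restrict-[]≔ : ∀ {m} (M : Subset m) (c : Vec 𝔯 m) k b →
                 restrict (M [ k ]≔ b) c ≡ restrict M c [ k ]≔ (if b then Vec.lookup c k else 𝔑.0#)
  restrict-[]≔ (_ ∷ M) (x ∷ c) zero    b = ≡.refl
  restrict-[]≔ (_ ∷ M) (x ∷ c) (suc k) b = ≡.cong (_ ∷_) (restrict-[]≔ M c k b)

  LSub-restrict : ∀ {m p} (K : Vec (Fin m) p) (bs : Subset p) (c : Vec 𝔯 m) →
                  LSub K (Vec.map (Vec.lookup c) K) bs ≡ restrict (scatter false K bs) c
  LSub-restrict []      []       c = ≡.sym (restrict-⊥ c)
  LSub-restrict (k ∷ K) (b ∷ bs) c =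
    ≡.trans (≡.cong (_[ k ]≔ _) (LSub-restrict K bs c)) (≡.sym (restrict-[]≔ (scatter false K bs) c k b))

  toSubset-⊆ᵇ-support : ∀ {m p} (K : Vec (Fin m) p) → Increasing K → (c : Vec 𝔯 m) →
                        toSubset K ⊆ᵇ support c ≡ allNonzero (Vec.map (Vec.lookup c) K)
  toSubset-⊆ᵇ-support {zero} [] _ [] = ≡.refl
  toSubset-⊆ᵇ-support {suc m} K inc (x ∷ c) with increasingView K inc
  ... | avoids-zero K' i rewrite scatter-suc false K' (Vec.replicate _ true) =
    ≡.trans (toSubset-⊆ᵇ-support K' i c) (≡.cong allNonzero (Vec.map-∘ (Vec.lookup (x ∷ c)) suc K'))
  ... | from-zero K' i rewrite scatter-zero false K' true (Vec.replicate _ true) =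
    ≡.trans (head-⊆ᵇ (isNonzero x)) (≡.cong (isNonzero x ∧_)
      (≡.trans (toSubset-⊆ᵇ-support K' i c) (≡.cong allNonzero (Vec.map-∘ (Vec.lookup (x ∷ c)) suc K'))))
    where
    head-⊆ᵇ : ∀ s {M N : Subset m} → (true ∷ M) ⊆ᵇ (s ∷ N) ≡ s ∧ (M ⊆ᵇ N)
    head-⊆ᵇ true  = ≡.refl
    head-⊆ᵇ false = ≡.refl

  module Substitution (g n : ℕ) (C : Vec 𝔯 n → Set) (C? : Decidable C) (v : Vec 𝔯 n)
                      (y yinv : Vec 𝔯 (suc g) → Carrier) (inverse : ∀ a → y a * yinv a ≈ 1#) where

    X : (p : ℕ) → Vec (Fin (suc g)) p → Vec 𝔯 p → Carrier
    X = substX g n C C? v y yinv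

    -- The paper's X_{K,L} ← ∏_{K' ⊂ K} y_{L_{K'}}^{(-1)^{|K|-|K'|}} at every size; substX uses the form
    -- y_{L_(k)}/y_0 when |K| = 1, which is the same value.
    alternatingX : (p : ℕ) → Vec (Fin (suc g)) p → Vec 𝔯 p → Carrier
    alternatingX p K L =
      ∏ (map (λ bs → if isEven (countFalse bs) then y (LSub K L bs) else yinv (LSub K L bs)) (subsets p))

    X≈alternatingX : ∀ p K L → X p K L ≈ alternatingX p K L
    X≈alternatingX zero          []       []       = refl
    X≈alternatingX (suc zero)    (k ∷ []) (l ∷ []) =
      *-congˡ (trans (reflexive (≡.cong yinv (≡.sym zeroV[k]≔0))) (sym (*-identityʳ _)))
      where
      zeroV[k]≔0 : zeroV [ k ]≔ 𝔑.0# ≡ zeroV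
      zeroV[k]≔0 = ≡.trans (≡.cong (zeroV [ k ]≔_) (≡.sym (Vec.lookup-replicate k 𝔑.0#))) (Vec.[]≔-lookup zeroV k)
    X≈alternatingX (suc (suc p)) K        L        = refl

    last : Fin (suc g)
    last = Fin.fromℕ g

    Xfix-last : ∀ L → Xfix g n C C? v X 1 (last ∷ []) L ≡ 1#
    Xfix-last L with last Fin.≟ last
    ... | yes _         = ≡.refl
    ... | no last≢last = ⊥-elim (last≢last ≡.refl)

    Xfix-other : ∀ {k} → k ≢ last → ∀ L → Xfix g n C C? v X 1 (k ∷ []) L ≡ X 1 (k ∷ []) L
    Xfix-other {k} k≢last L with k Fin.≟ last
    ... | yes k≡last = ⊥-elim (k≢last k≡last)
    ... | no _       = ≡.refl

    lastSubset : Subset (suc g)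
    lastSubset = toSubset (last ∷ [])

    lastSubset≢ : ∀ {p} (K : Vec (Fin (suc g)) p) → Increasing K → p ≢ 1 → lastSubset ≢ toSubset K
    lastSubset≢ K inc p≢1 eq =
      p≢1 (≡.trans (≡.sym (∣toSubset∣ K inc))
                   (≡.trans (≡.cong ∣_∣ (≡.sym eq)) (∣toSubset∣ (last ∷ []) ≡.refl)))

    Y₁ : 𝔯 → Carrier
    Y₁ l = y (Lk last l) * yinv zeroV

    module _ (c : Vec 𝔯 (suc g)) where

      zᶜ : Signed (suc g)
      zᶜ M b = if b then y (restrict M c) else yinv (restrict M c)

      alternatingX-column : ∀ {p} (K : Vec (Fin (suc g)) p) → Increasing K →
                            alternatingX p K (Vec.map (Vec.lookup c) K) ≈ alternating zᶜ true (toSubset K)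
      alternatingX-column {p} K inc =
        trans (∏-cong (subsets p) on-image)
              (∏-reindex _≟ₛ_ (subsets (suc g)) (subsets-unique _) ∈-subsets (subsets p) (scatter false K)
                 (Unique.map⁺ (scatter-injective false K inc _ _) (subsets-unique p)) _ off-image)
        where
        term : Subset (suc g) → Carrier
        term M = if M ⊆ᵇ toSubset K then zᶜ M (if isEven ∣ toSubset K ─ M ∣ then true else false) else 1#
        on-image : ∀ bs → (if isEven (countFalse bs) then y (LSub K (Vec.map (Vec.lookup c) K) bs)
                                                   else yinv (LSub K (Vec.map (Vec.lookup c) K) bs))
                          ≈ term (scatter false K bs)
        on-image bs rewrite LSub-restrict K bs c | scatter-⊆ᵇ K inc bs | ∣toSubset─scatter∣ K inc bs
          with isEven (countFalse bs)
        ... | true  = refl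
        ... | false = refl
        off-image : ∀ M → M ∉ map (scatter false K) (subsets p) → term M ≈ 1#
        off-image M M∉ with M ⊆ᵇ toSubset K in M⊆
        ... | false = refl
        ... | true  = let bs , eq = ⊆ᵇ-toSubset⇒scatter K inc M M⊆ in
                      ⊥-elim (M∉ (≡.subst (_∈ map (scatter false K) (subsets p)) eq
                                          (∈-map⁺ (scatter false K) (∈-subsets bs))))

      selected : (p : ℕ) → Vec (Fin (suc g)) p → Carrier
      selected p K = if toSubset K ⊆ᵇ support c then X p K (Vec.map (Vec.lookup c) K) else 1#

      -- Möbius inversion over the subsets of the support of c, which are exactly the K with all c_K nonzero.
      y≈∏-selected : y c ≈ y zeroV * ∏-tuples (suc g) selected
      y≈∏-selected = begin
        y c                                          ≡⟨ ≡.cong y (≡.sym (restrict-support c)) ⟩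
        zᶜ (support c) true                          ≈⟨ sym (möbius-inversion zᶜ (λ M → inverse (restrict M c)) true _) ⟩
        ∏⊆ (support c) (alternating zᶜ true)        ≈⟨ ∏-subsets-by-size (suc g) h ⟩
        h ⊥ * ∏-tuples (suc g) (λ _ → h ∘ toSubset)  ≈⟨ *-cong (trans (h-selected 0 [] ≡.refl) selected-∅)
                                                               (∏-tuples-cong (suc g) h-selected) ⟩
        y zeroV * ∏-tuples (suc g) selected          ∎
        where
        h : Subset (suc g) → Carrier
        h M = if M ⊆ᵇ support c then alternating zᶜ true M else 1#
        h-selected : ∀ p (K : Vec (Fin (suc g)) p) → Increasing K → h (toSubset K) ≈ selected p K
        h-selected p K inc with toSubset K ⊆ᵇ support c
        ... | true  = sym (trans (X≈alternatingX p K _) (alternatingX-column K inc))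
        ... | false = refl
        selected-∅ : selected 0 [] ≈ y zeroV
        selected-∅ rewrite toSubset-⊆ᵇ-support [] ≡.refl c = *-identityʳ _

      selectedFix : (p : ℕ) → Vec (Fin (suc g)) p → Carrier
      selectedFix p K = if toSubset K ⊆ᵇ support c then Xfix g n C C? v X p K (Vec.map (Vec.lookup c) K) else 1#

      lastFactor : Subset (suc g) → Carrier
      lastFactor M = δ _≟ₛ_ lastSubset M (selected 1 (last ∷ []))

      lastFactor-off : ∀ {M} → lastSubset ≢ M → lastFactor M ≈ 1#
      lastFactor-off {M} last≢M = reflexive (≡.cong (if_then _ else 1#) (dec-false (lastSubset ≟ₛ M) last≢M))

      ∏-lastFactor : ∏-tuples (suc g) (λ _ → lastFactor ∘ toSubset) ≈ selected 1 (last ∷ [])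
      ∏-lastFactor = begin
        ∏-tuples (suc g) (λ _ → lastFactor ∘ toSubset)
          ≈⟨ sym (*-identityˡ _) ⟩
        1# * ∏-tuples (suc g) (λ _ → lastFactor ∘ toSubset)
          ≈⟨ *-congʳ (sym (lastFactor-off (lastSubset≢ [] ≡.refl λ ()))) ⟩
        lastFactor ⊥ * ∏-tuples (suc g) (λ _ → lastFactor ∘ toSubset)
          ≈⟨ sym (∏-subsets-by-size (suc g) lastFactor) ⟩
        ∏ (map lastFactor (subsets (suc g)))
          ≈⟨ ∏-δ _≟ₛ_ (subsets (suc g)) (subsets-unique _) (∈-subsets lastSubset) (λ _ → selected 1 (last ∷ [])) ⟩
        selected 1 (last ∷ []) ∎

      -- Xfix differs from X only at K = (g+1), whose factor lastFactor splits off.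
      selected≈lastFactor*selectedFix : ∀ p K → Increasing K → selected p K ≈ lastFactor (toSubset K) * selectedFix p K
      selected≈lastFactor*selectedFix (suc zero) (k ∷ []) _ = singleton (k Fin.≟ last)
        where
        singleton : Dec (k ≡ last) → selected 1 (k ∷ []) ≈ lastFactor (toSubset (k ∷ [])) * selectedFix 1 (k ∷ [])
        singleton (yes ≡.refl) =
          trans (sym (*-identityʳ _)) (*-cong (sym (δ-refl _≟ₛ_ lastSubset _)) (reflexive (≡.sym fix≡1)))
          where
          fix≡1 : selectedFix 1 (last ∷ []) ≡ 1#
          fix≡1 rewrite Xfix-last (Vec.lookup c last ∷ []) with toSubset (last ∷ []) ⊆ᵇ support c
          ... | true  = ≡.refl
          ... | false = ≡.refl
        singleton (no k≢last) =
          trans (sym (*-identityˡ _)) (*-cong (sym (lastFactor-off last≢k)) (reflexive (≡.sym fix≡selected)))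
          where
          last≢k : lastSubset ≢ toSubset (k ∷ [])
          last≢k eq = k≢last (Vec.∷-injectiveˡ (toSubset-injective (k ∷ []) (last ∷ []) ≡.refl ≡.refl (≡.sym eq)))
          fix≡selected : selectedFix 1 (k ∷ []) ≡ selected 1 (k ∷ [])
          fix≡selected rewrite Xfix-other k≢last (Vec.lookup c k ∷ []) = ≡.refl
      selected≈lastFactor*selectedFix zero [] inc =
        trans (sym (*-identityˡ _)) (*-congʳ (sym (lastFactor-off (lastSubset≢ [] inc λ ()))))
      selected≈lastFactor*selectedFix (suc (suc p)) K inc =
        trans (sym (*-identityˡ _)) (*-congʳ (sym (lastFactor-off (lastSubset≢ K inc λ ()))))

      ∏-selected-last : ∏-tuples (suc g) selected ≈ selected 1 (last ∷ []) * ∏-tuples (suc g) selectedFix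
      ∏-selected-last = begin
        ∏-tuples (suc g) selected
          ≈⟨ ∏-tuples-cong (suc g) selected≈lastFactor*selectedFix ⟩
        ∏-tuples (suc g) (λ p K → lastFactor (toSubset K) * selectedFix p K)
          ≈⟨ ∏-tuples-distrib (suc g) _ _ ⟩
        ∏-tuples (suc g) (λ _ → lastFactor ∘ toSubset) * ∏-tuples (suc g) selectedFix
          ≈⟨ *-congʳ ∏-lastFactor ⟩
        selected 1 (last ∷ []) * ∏-tuples (suc g) selectedFix ∎

      prefactor-column : Carrier
      prefactor-column = ∏ (map (λ l → δ _≟_ (Vec.lookup c last) l (Y₁ l)) nonzero)

      iJac-column : Carrier
      iJac-column = ∏-tuples (suc g) λ p K →
        ∏ (map (λ L → δ (Vec.≡-dec _≟_) (Vec.map (Vec.lookup c) K) L (Xfix g n C C? v X p K L)) (vecsOf nonzero p))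

      prefactor-column≈selected : prefactor-column ≈ selected 1 (last ∷ [])
      prefactor-column≈selected =
        trans (∏-δ-⇔ _≟_ nonzero nonzero-unique (isNonzero (Vec.lookup c last)) ∈-nonzero⇔ Y₁)
              (reflexive (≡.cong (if_then Y₁ (Vec.lookup c last) else 1#)
                (≡.sym (≡.trans (toSubset-⊆ᵇ-support (last ∷ []) ≡.refl c) (∧-identityʳ _)))))

      iJac-column≈selectedFix : iJac-column ≈ ∏-tuples (suc g) selectedFix
      iJac-column≈selectedFix = ∏-tuples-cong (suc g) λ p K inc →
        trans (∏-δ-⇔ (Vec.≡-dec _≟_) (vecsOf nonzero p) (vecsOf-unique nonzero-unique p) _ ∈-nonzeroVecs⇔
                     (Xfix g n C C? v X p K))
              (reflexive (≡.cong (if_then Xfix g n C C? v X p K (Vec.map (Vec.lookup c) K) else 1#)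
                (≡.sym (toSubset-⊆ᵇ-support K inc c))))

      column-identity : y c ≈ (y zeroV * prefactor-column) * iJac-column
      column-identity = begin
        y c
          ≈⟨ y≈∏-selected ⟩
        y zeroV * ∏-tuples (suc g) selected
          ≈⟨ *-congˡ ∏-selected-last ⟩
        y zeroV * (selected 1 (last ∷ []) * ∏-tuples (suc g) selectedFix)
          ≈⟨ *-congˡ (*-cong (sym prefactor-column≈selected) (sym iJac-column≈selectedFix)) ⟩
        y zeroV * (prefactor-column * iJac-column)
          ≈⟨ sym (*-assoc _ _ _) ⟩
        (y zeroV * prefactor-column) * iJac-column ∎

    prefactor : Carrier
    prefactor = pow (y zeroV) n * prodL (map (λ l → pow (Y₁ l) (wt l v)) nonzero)

    pow≡^ : ∀ x k → pow x k ≡ x ^ k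
    pow≡^ x zero    = ≡.refl
    pow≡^ x (suc k) = ≡.cong (x *_) (pow≡^ x k)

    module _ (us : Vec (Vec 𝔯 n) g) where

      column : Fin n → Vec 𝔯 (suc g)
      column i = Vec.map (λ w → Vec.lookup w i) (us ∷ʳ v)

      column-last : ∀ i → Vec.lookup (column i) last ≡ Vec.lookup v i
      column-last i = ≡.trans (Vec.lookup-map last _ (us ∷ʳ v)) (≡.cong (λ w → Vec.lookup w i) (lookup-∷ʳ-last us))
        where
        lookup-∷ʳ-last : ∀ {k} (ws : Vec (Vec 𝔯 n) k) → Vec.lookup (ws ∷ʳ v) (Fin.fromℕ k) ≡ v
        lookup-∷ʳ-last []       = ≡.refl
        lookup-∷ʳ-last (_ ∷ ws) = lookup-∷ʳ-last ws

      column-restrict : ∀ {p} (K : Vec (Fin (suc g)) p) i →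
                        Vec.map (λ w → Vec.lookup w i) (Vec.map (Vec.lookup (us ∷ʳ v)) K)
                          ≡ Vec.map (Vec.lookup (column i)) K
      column-restrict K i =
        ≡.trans (≡.sym (Vec.map-∘ _ _ K)) (Vec.map-cong (λ k → ≡.sym (Vec.lookup-map k _ (us ∷ʳ v))) K)

      hJac-term : Carrier
      hJac-term = ∏ (map (λ a → pow (y a) (nc (us ∷ʳ v) a)) (vecsOf elems (suc g)))

      iJac-term : Carrier
      iJac-term = ∏-tuples (suc g) λ p K →
        ∏ (map (λ L → pow (Xfix g n C C? v X p K L) (nc (Vec.map (Vec.lookup (us ∷ʳ v)) K) L)) (vecsOf nonzero p))

      hJac-term≈∏-columns : hJac-term ≈ ∏ (map (y ∘ column) (allFin n))
      hJac-term≈∏-columns = begin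
        hJac-term
          ≈⟨ ∏-cong (vecsOf elems (suc g)) (λ a →
               trans (reflexive (pow≡^ (y a) (nc (us ∷ʳ v) a)))
                     (∏-indicator (λ i → Vec.≡-dec _≟_ (column i) a) (allFin n) (y a))) ⟩
        ∏ (map (λ a → ∏ (map (λ i → δ (Vec.≡-dec _≟_) (column i) a (y a)) (allFin n))) (vecsOf elems (suc g)))
          ≈⟨ ∏-swap (vecsOf elems (suc g)) (allFin n) _ ⟩
        ∏ (map (λ i → ∏ (map (λ a → δ (Vec.≡-dec _≟_) (column i) a (y a)) (vecsOf elems (suc g)))) (allFin n))
          ≈⟨ ∏-cong (allFin n) (λ i → ∏-δ (Vec.≡-dec _≟_) (vecsOf elems (suc g)) (vecsOf-unique elems-unique _)
                                           (∈-vecsOf complete (column i)) y) ⟩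
        ∏ (map (y ∘ column) (allFin n)) ∎

      iJac-term≈∏-columns : iJac-term ≈ ∏ (map (iJac-column ∘ column) (allFin n))
      iJac-term≈∏-columns = begin
        iJac-term
          ≈⟨ ∏-tuples-cong (suc g) (λ p K _ → ∏-cong (vecsOf nonzero p) λ L →
               trans (reflexive (pow≡^ (Xfix g n C C? v X p K L) (nc (Vec.map (Vec.lookup (us ∷ʳ v)) K) L)))
                     (∏-indicator (λ i → Vec.≡-dec _≟_ (entries i K) L) (allFin n) (Xfix g n C C? v X p K L))) ⟩
        ∏-tuples (suc g) (λ p K → ∏ (map (λ L → ∏ (map (λ i → term i p K L) (allFin n))) (vecsOf nonzero p)))
          ≈⟨ ∏-tuples-cong (suc g) (λ p K _ → ∏-swap (vecsOf nonzero p) (allFin n) _) ⟩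
        ∏-tuples (suc g) (λ p K → ∏ (map (λ i → ∏ (map (term i p K) (vecsOf nonzero p))) (allFin n)))
          ≈⟨ ∏-tuples-swap (suc g) (allFin n) (λ p K i → ∏ (map (term i p K) (vecsOf nonzero p))) ⟩
        ∏ (map (λ i → ∏-tuples (suc g) (λ p K → ∏ (map (term i p K) (vecsOf nonzero p)))) (allFin n))
          ≈⟨ ∏-cong (allFin n) (λ i → ∏-tuples-cong (suc g) λ p K _ → ∏-cong (vecsOf nonzero p) λ L →
               reflexive (≡.cong (λ u → δ (Vec.≡-dec _≟_) u L (Xfix g n C C? v X p K L)) (column-restrict K i))) ⟩
        ∏ (map (iJac-column ∘ column) (allFin n)) ∎
        where
        entries : Fin n → ∀ {p} → Vec (Fin (suc g)) p → Vec 𝔯 p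
        entries i K = Vec.map (λ w → Vec.lookup w i) (Vec.map (Vec.lookup (us ∷ʳ v)) K)
        term : Fin n → (p : ℕ) → Vec (Fin (suc g)) p → Vec 𝔯 p → Carrier
        term i p K L = δ (Vec.≡-dec _≟_) (entries i K) L (Xfix g n C C? v X p K L)

      prefactor≈∏-columns : prefactor ≈ ∏ (map (λ i → y zeroV * prefactor-column (column i)) (allFin n))
      prefactor≈∏-columns = begin
        prefactor
          ≈⟨ *-cong (reflexive y₀-power) (∏-cong nonzero weight-indicator) ⟩
        ∏ (map (λ _ → y zeroV) (allFin n)) * ∏ (map (λ l → ∏ (map (λ i → vᵢ=l i l) (allFin n))) nonzero)
          ≈⟨ *-congˡ (∏-swap nonzero (allFin n) _) ⟩
        ∏ (map (λ _ → y zeroV) (allFin n)) * ∏ (map (λ i → ∏ (map (vᵢ=l i) nonzero)) (allFin n))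
          ≈⟨ sym (∏-distrib (allFin n) _ _) ⟩
        ∏ (map (λ i → y zeroV * ∏ (map (vᵢ=l i) nonzero)) (allFin n))
          ≡⟨ ≡.cong ∏ (List.map-cong (λ i → ≡.cong (λ x → y zeroV * ∏ (map (λ l → δ _≟_ x l (Y₁ l)) nonzero))
                                                    (≡.sym (column-last i))) (allFin n)) ⟩
        ∏ (map (λ i → y zeroV * prefactor-column (column i)) (allFin n)) ∎
        where
        vᵢ=l : Fin n → 𝔯 → Carrier
        vᵢ=l i l = δ _≟_ (Vec.lookup v i) l (Y₁ l)
        y₀-power : pow (y zeroV) n ≡ ∏ (map (λ _ → y zeroV) (allFin n))
        y₀-power = ≡.trans (pow≡^ (y zeroV) n) (≡.sym (≡.trans (∏-const (allFin n) (y zeroV))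
                                                          (≡.cong (y zeroV ^_) (List.length-tabulate {n = n} id))))
        weight-indicator : ∀ l → pow (Y₁ l) (wt l v) ≈ ∏ (map (λ i → vᵢ=l i l) (allFin n))
        weight-indicator l =
          trans (reflexive (pow≡^ (Y₁ l) (wt l v))) (∏-indicator (λ i → Vec.lookup v i ≟ l) (allFin n) (Y₁ l))

      term-identity : hJac-term ≈ prefactor * iJac-term
      term-identity = begin
        hJac-term
          ≈⟨ hJac-term≈∏-columns ⟩
        ∏ (map (y ∘ column) (allFin n))
          ≈⟨ ∏-cong (allFin n) (column-identity ∘ column) ⟩
        ∏ (map (λ i → (y zeroV * prefactor-column (column i)) * iJac-column (column i)) (allFin n))
          ≈⟨ ∏-distrib (allFin n) _ _ ⟩
        ∏ (map (λ i → y zeroV * prefactor-column (column i)) (allFin n)) * ∏ (map (iJac-column ∘ column) (allFin n))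
          ≈⟨ sym (*-cong prefactor≈∏-columns iJac-term≈∏-columns) ⟩
        prefactor * iJac-term ∎

    jacobi-identity : hJac g n C C? v y ≈ rhs g n C C? v y yinv
    jacobi-identity = trans (∑-cong (codeTuples C C? g) term-identity)
                            (sym (*-distribˡ-∑ prefactor (codeTuples C C? g) iJac-term))

-- Only the finiteness data (elems, _≟_) and the invertibility of the y_a are used: the identity holds
-- coordinatewise for every finite commutative ring and every set of codewords.
theorem3p3 : {c ℓ : Level}
    (R : CommutativeRing 0ℓ 0ℓ)
    → (∀ {x y} → CommutativeRing._≈_ R x y → x ≡ y)
    → (_≟_ : DecidableEquality (CommutativeRing.Carrier R))
    → (elems : List (CommutativeRing.Carrier R))
    → (∀ x → x ∈ elems) → Unique elems
    → IsField R ⊎ IsZmod R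
    → (g n : ℕ) → 1 ≤ g → 1 ≤ n
    → (C : Vec (CommutativeRing.Carrier R) n → Set) → (C? : Decidable C)
    → IsLinearCode R C
    → (v : Vec (CommutativeRing.Carrier R) n)
    → (S : CommutativeRing c ℓ)
    → (y yinv : Vec (CommutativeRing.Carrier R) (suc g) → CommutativeRing.Carrier S)
    → (∀ a → CommutativeRing._≈_ S (CommutativeRing._*_ S (y a) (yinv a)) (CommutativeRing.1# S))
    → CommutativeRing._≈_ S
        (Jacobi.hJac R _≟_ elems S g n C C? v y)
        (Jacobi.rhs R _≟_ elems S g n C C? v y yinv)
theorem3p3 R _ _≟_ elems complete elems-unique _ g n _ _ C C? _ v S y yinv inverse =
  JacobiIdentity.Substitution.jacobi-identity R _≟_ elems complete elems-unique S g n C C? v y yinv inverse
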